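{- For each positive integer $m$ there is an integer $t_0$ such that for every integer $t\ge t_0$ the independence polynomial $I(TG_{m,t})=\sum_{k\ge 0}s_k x^k$ of the tree $TG_{m,t}$ breaks log-concavity at $m$ indices, i.e. there are $m$ distinct indices $k$ with $s_k^2< s_{k-1}s_{k+1}$.
   Context: For a simple graph $G$, the independence polynomial is $I(G)=\sum_{k\ge0}s_kx^k$, where $s_k$ is the number of independent sets of $G$ of size $k$. A sequence $(s_k)$ breaks log-concavity at index $k$ if $s_k^2<s_{k-1}s_{k+1}$. Let $P_n$ be the path on $n$ vertices. For nonnegative integers $m,t$: $S_{2,t}$ is the tree with a root $w$ to which $t$ copies of $P_2$ are attached (i.e. $w$ is adjacent to one endpoint of each copy); $T_{m,t}$ is the tree with a root $v$ having $m$ children, each of which has $t$ pendant copies of $P_2$ attached; $TG_{m,t}$ is obtained by taking $m$ disjoint copies of $T_{3,t}$, joining the root $v$ of each copy to a new vertex $v_0$, and adding one further vertex adjacent only to $v_0$. -}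

module Defs where

open import Data.Nat using (ℕ; zero; suc; _+_; _*_; _∸_; _≤_; _<_; _≡ᵇ_)
open import Data.Bool using (Bool; true; false; _∧_; not)
open import Data.List using (List; []; _∷_; _++_; map; length; filterᵇ; replicate)
open import Data.Vec using (Vec; []; _∷_)
open import Data.Product using (_×_; _,_)

-- Finite simple graphs on vertex set {0,…,n-1}, given by an edge list.

record Graph : Set where
  constructor graph
  field
    order : ℕ
    edges : List (ℕ × ℕ)
open Graph public

-- A subset of {0,…,n-1} as a characteristic vector; membership of a
-- natural number (false outside the range).
_∈ᵇ_ : {n : ℕ} → ℕ → Vec Bool n → Bool
_ ∈ᵇ [] = false
zero ∈ᵇ (b ∷ _) = b
suc i ∈ᵇ (_ ∷ bs) = i ∈ᵇ bs

card : {n : ℕ} → Vec Bool n → ℕ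
card [] = 0
card (true ∷ bs) = suc (card bs)
card (false ∷ bs) = card bs

allSubsets : (n : ℕ) → List (Vec Bool n)
allSubsets zero = [] ∷ []
allSubsets (suc n) = map (true ∷_) (allSubsets n) ++ map (false ∷_) (allSubsets n)

allᵇ : {A : Set} → (A → Bool) → List A → Bool
allᵇ p [] = true
allᵇ p (x ∷ xs) = p x ∧ allᵇ p xs

isIndependent : (G : Graph) → Vec Bool (order G) → Bool
isIndependent G S = allᵇ (λ { (i , j) → not ((i ∈ᵇ S) ∧ (j ∈ᵇ S)) }) (edges G)

indepCoeff : Graph → ℕ → ℕ
indepCoeff G k =
  length (filterᵇ (λ S → isIndependent G S ∧ (card S ≡ᵇ k)) (allSubsets (order G)))

-- Rooted trees and their underlying graphs (preorder numbering,
-- root = vertex 0, edges parent–child).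

data Tree : Set where
  node : List Tree → Tree

mutual
  size : Tree → ℕ
  size (node ts) = suc (sizes ts)

  sizes : List Tree → ℕ
  sizes [] = 0
  sizes (t ∷ ts) = size t + sizes ts

mutual
  treeEdges : ℕ → Tree → List (ℕ × ℕ)
  treeEdges l (node ts) = childEdges l (suc l) ts

  -- parent label p, first free label c
  childEdges : ℕ → ℕ → List Tree → List (ℕ × ℕ)
  childEdges p c [] = []
  childEdges p c (t ∷ ts) = (p , c) ∷ (treeEdges c t ++ childEdges p (c + size t) ts)

toGraph : Tree → Graph
toGraph t = graph (size t) (treeEdges 0 t)

-- P_2 rooted at an endpoint (so attaching it means joining to that endpoint)
P2 : Tree
P2 = node (node [] ∷ [])

T : ℕ → ℕ → Tree
T m t = node (replicate m (node (replicate t P2)))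

TG : ℕ → ℕ → Tree
TG m t = node (node [] ∷ replicate m (T 3 t))

-- log-concavity breaking: s_k^2 < s_{k-1} s_{k+1}  (k ≥ 1; for k = 0,
-- s_{-1} = 0 so it can never break there)

BreaksLCAt : (ℕ → ℕ) → ℕ → Set
BreaksLCAt s k = (1 ≤ k) × (s k * s k < s (k ∸ 1) * s (suc k))

-- Expanding the independence polynomial at the root, I(T) = x·I(T − N[r]) + I(T − r), gives
-- I(TG_{m,t}) in closed form. Its log-concavity breaks sit just below the top degree
-- N = 1 + 3m(t+1), so we read them off the reciprocal R(x) = x^N I(1/x), which is
--   ((1+x)^t + x(2+x)^t)^{3m} + (1+x)·(x²(2+x)^{3t} + ((1+x)^t + x(2+x)^t)³)^m.
-- Put L = 2^t and A = 6L. Taking x²·2^{3t} from i of the last m factors shows that the coefficient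
-- of x^{2i} in R is at least L^{3i}. Conversely, giving x^e the weight W(e) ∝ 1/(A^e L^{⌊e/2⌋})
-- for e ≤ 2m makes the total weight of a product at most the product of the total weights, and the
-- total weight of R is at most 3·28^m·W(0); hence the coefficient of x^j is at most
-- 3·28^m·A^j L^{⌊j/2⌋} for j ≤ 2m. For j = 2a+1 < 2m the square of this bound is
-- (3·28^m·6^j)² L^{6a+2}, while the neighbouring coefficients multiply to at least L^{6a+3}.
-- So every odd j < 2m is a break as soon as 2^t exceeds (3·28^m·6^{2m})².

module Submission where

open import Defs
open import Data.Nat
  using (ℕ; zero; suc; pred; _+_; _*_; _∸_; _^_; _≤_; _<_; _≡ᵇ_; _≟_; _≤?_; z≤n; s≤s; NonZero; >-nonZero⁻¹; ⌊_/2⌋)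
open import Data.Nat.Properties
open import Data.Nat.ListAction using (sum)
open import Data.Nat.ListAction.Properties using (sum-++)
open import Data.Nat.Tactic.RingSolver using (solve-∀)
open import Algebra.Properties.CommutativeSemigroup *-commutativeSemigroup
  using (xy∙z≈xz∙y; xy∙z≈y∙xz; x∙yz≈xz∙y; x∙yz≈y∙xz)
open import Data.Bool using (Bool; true; false; _∧_; not; T?)
open import Data.Bool.Properties using (∧-assoc)
open import Data.List using (List; []; _∷_; _++_; map; length; filter; filterᵇ; replicate; cartesianProductWith)
open import Data.List.Properties
  using (filter-++; filter-accept; filter-reject; filter-none; length-++; map-++; map-∘; map-cong; map-cong-local;
         map-id; ++-identityʳ; cartesianProductWith-distribʳ-++)
open import Data.List.Relation.Unary.All using (All; []; _∷_)
import Data.List.Relation.Unary.All as All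
open import Data.List.Relation.Unary.All.Properties using (++⁺; gmap⁺)
open import Data.Vec using (Vec; []; _∷_) renaming (_++_ to _++ᵛ_)
open import Data.Fin using (Fin; toℕ)
open import Data.Fin.Properties using (toℕ<n; toℕ-injective)
open import Data.Product using (Σ; _×_; _,_)
open import Function using (_∘_)
open import Function.Definitions using (Injective)
open import Relation.Binary.PropositionalEquality
open import Relation.Nullary using (Dec; yes; no; ¬_)
open import Relation.Nullary.Negation using (contradiction)

-- Polynomials with coefficients in ℕ

-- A polynomial is the multiset of the exponents of its monomials: 1 ∷ 1 ∷ 0 ∷ [] is 2x + 1.
Poly : Set
Poly = List ℕ

coeff : ℕ → Poly → ℕ
coeff k K = length (filter (_≟ k) K)

shift : ℕ → Poly → Poly
shift a = map (a +_)

infixl 7 _⊗_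
_⊗_ : Poly → Poly → Poly
_⊗_ = cartesianProductWith _+_

infixl 8 _^ᴾ_
_^ᴾ_ : Poly → ℕ → Poly
K ^ᴾ zero = 0 ∷ []
K ^ᴾ suc n = K ⊗ K ^ᴾ n

⊗-identityˡ : ∀ K → (0 ∷ []) ⊗ K ≡ K
⊗-identityˡ K = trans (++-identityʳ (shift 0 K)) (map-id K)

coeff-∷-≡ : ∀ k K → coeff k (k ∷ K) ≡ suc (coeff k K)
coeff-∷-≡ k K = cong length (filter-accept (_≟ k) refl)

coeff-∷-≢ : ∀ {x k} K → x ≢ k → coeff k (x ∷ K) ≡ coeff k K
coeff-∷-≢ K x≢k = cong length (filter-reject (_≟ _) x≢k)

coeff-++ : ∀ k K L → coeff k (K ++ L) ≡ coeff k K + coeff k L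
coeff-++ k K L = trans (cong length (filter-++ (_≟ k) K L)) (length-++ (filter (_≟ k) K))

coeff-++ˡ : ∀ k K L → coeff k K ≤ coeff k (K ++ L)
coeff-++ˡ k K L = ≤-trans (m≤m+n (coeff k K) (coeff k L)) (≤-reflexive (sym (coeff-++ k K L)))

coeff-++ʳ : ∀ k K L → coeff k L ≤ coeff k (K ++ L)
coeff-++ʳ k K L = ≤-trans (m≤n+m (coeff k L) (coeff k K)) (≤-reflexive (sym (coeff-++ k K L)))

coeff-map : ∀ {f : ℕ → ℕ} {k} K → All (λ x → f x ≡ f k → x ≡ k) K →
  coeff (f k) (map f K) ≡ coeff k K
coeff-map [] [] = refl
coeff-map {f} {k} (x ∷ K) (inj ∷ injs) with x ≟ k
... | yes refl = begin
  coeff (f x) (f x ∷ map f K) ≡⟨ coeff-∷-≡ (f x) (map f K) ⟩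
  suc (coeff (f x) (map f K)) ≡⟨ cong suc (coeff-map K injs) ⟩
  suc (coeff x K)             ≡⟨ coeff-∷-≡ x K ⟨
  coeff x (x ∷ K)             ∎
  where open ≡-Reasoning
... | no x≢k = begin
  coeff (f k) (f x ∷ map f K) ≡⟨ coeff-∷-≢ (map f K) (x≢k ∘ inj) ⟩
  coeff (f k) (map f K)       ≡⟨ coeff-map K injs ⟩
  coeff k K                   ≡⟨ coeff-∷-≢ K x≢k ⟨
  coeff k (x ∷ K)             ∎
  where open ≡-Reasoning

coeff-shift : ∀ a k K → coeff (a + k) (shift a K) ≡ coeff k K
coeff-shift a k K = coeff-map K (All.universal (λ x → +-cancelˡ-≡ a x k) K)

coeff-⊗ : ∀ a b K L → coeff a K * coeff b L ≤ coeff (a + b) (K ⊗ L)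
coeff-⊗ a b [] L = z≤n
coeff-⊗ a b (x ∷ K) L with x ≟ a
... | yes refl = begin
  coeff x (x ∷ K) * coeff b L               ≡⟨ cong (_* coeff b L) (coeff-∷-≡ x K) ⟩
  coeff b L + coeff x K * coeff b L         ≤⟨ +-mono-≤ (≤-reflexive (sym (coeff-shift x b L))) (coeff-⊗ x b K L) ⟩
  coeff (x + b) (shift x L) + coeff (x + b) (K ⊗ L) ≡⟨ coeff-++ (x + b) (shift x L) (K ⊗ L) ⟨
  coeff (x + b) ((x ∷ K) ⊗ L)               ∎
  where open ≤-Reasoning
... | no x≢a = begin
  coeff a (x ∷ K) * coeff b L               ≡⟨ cong (_* coeff b L) (coeff-∷-≢ K x≢a) ⟩
  coeff a K * coeff b L                     ≤⟨ coeff-⊗ a b K L ⟩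
  coeff (a + b) (K ⊗ L)                     ≤⟨ m≤n+m _ _ ⟩
  coeff (a + b) (shift x L) + coeff (a + b) (K ⊗ L) ≡⟨ coeff-++ (a + b) (shift x L) (K ⊗ L) ⟨
  coeff (a + b) ((x ∷ K) ⊗ L)               ∎
  where open ≤-Reasoning

coeff-0-^ᴾ : ∀ K n → coeff 0 K ^ n ≤ coeff 0 (K ^ᴾ n)
coeff-0-^ᴾ K zero = ≤-refl
coeff-0-^ᴾ K (suc n) = ≤-trans (*-monoʳ-≤ (coeff 0 K) (coeff-0-^ᴾ K n)) (coeff-⊗ 0 0 K (K ^ᴾ n))

-- Choosing the monomial x^d from i of the n factors and 1 from the others.
coeff-^ᴾ : ∀ {K d c} → 1 ≤ coeff 0 K → c ≤ coeff d K →
  ∀ {i} n → i ≤ n → c ^ i ≤ coeff (i * d) (K ^ᴾ n)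
coeff-^ᴾ 1≤K₀ c≤K_d zero z≤n = ≤-refl
coeff-^ᴾ {K} 1≤K₀ c≤K_d {zero} (suc n) z≤n =
  ≤-trans (*-mono-≤ 1≤K₀ (coeff-^ᴾ 1≤K₀ c≤K_d n z≤n)) (coeff-⊗ 0 0 K (K ^ᴾ n))
coeff-^ᴾ {K} {d} 1≤K₀ c≤K_d {suc i} (suc n) (s≤s i≤n) =
  ≤-trans (*-mono-≤ c≤K_d (coeff-^ᴾ 1≤K₀ c≤K_d n i≤n)) (coeff-⊗ d (i * d) K (K ^ᴾ n))

DegreeAtMost : ℕ → Poly → Set
DegreeAtMost N = All (_≤ N)

degree-weaken : ∀ {M N K} → M ≤ N → DegreeAtMost M K → DegreeAtMost N K
degree-weaken M≤N = All.map (λ x≤M → ≤-trans x≤M M≤N)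

degree-shift : ∀ {N K} a → DegreeAtMost N K → DegreeAtMost (a + N) (shift a K)
degree-shift a = gmap⁺ (+-monoʳ-≤ a)

degree-⊗ : ∀ {a b K L} → DegreeAtMost a K → DegreeAtMost b L → DegreeAtMost (a + b) (K ⊗ L)
degree-⊗ [] dL = []
degree-⊗ (x≤a ∷ dK) dL = ++⁺ (gmap⁺ (+-mono-≤ x≤a) dL) (degree-⊗ dK dL)

degree-^ᴾ : ∀ {a K} n → DegreeAtMost a K → DegreeAtMost (n * a) (K ^ᴾ n)
degree-^ᴾ zero dK = z≤n ∷ []
degree-^ᴾ (suc n) dK = degree-⊗ dK (degree-^ᴾ n dK)

-- x^N K(1/x): the reciprocal of K, when K has degree at most N.
mirror : ℕ → Poly → Poly
mirror N = map (N ∸_)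

coeff-mirror : ∀ {N K j} → DegreeAtMost N K → j ≤ N → coeff j (mirror N K) ≡ coeff (N ∸ j) K
coeff-mirror {N} {K} {j} dK j≤N = begin
  coeff j (mirror N K)             ≡⟨ cong (λ i → coeff i (mirror N K)) (m∸[m∸n]≡n j≤N) ⟨
  coeff (N ∸ (N ∸ j)) (mirror N K) ≡⟨ coeff-map K (All.map (λ x≤N → ∸-cancelˡ-≡ x≤N (m∸n≤m N j)) dK) ⟩
  coeff (N ∸ j) K                  ∎
  where open ≡-Reasoning

∸-distrib-+ : ∀ {a b x y} → x ≤ a → y ≤ b → (a + b) ∸ (x + y) ≡ (a ∸ x) + (b ∸ y)
∸-distrib-+ {a} {b} {x} {y} x≤a y≤b = begin
  (a + b) ∸ (x + y) ≡⟨ ∸-+-assoc (a + b) x y ⟨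
  (a + b) ∸ x ∸ y   ≡⟨ cong (_∸ y) (+-∸-comm b x≤a) ⟩
  (a ∸ x) + b ∸ y   ≡⟨ +-∸-assoc (a ∸ x) y≤b ⟩
  (a ∸ x) + (b ∸ y) ∎
  where open ≡-Reasoning

mirror-shift : ∀ {a b x L} → x ≤ a → DegreeAtMost b L →
  mirror (a + b) (shift x L) ≡ shift (a ∸ x) (mirror b L)
mirror-shift {a} {b} {x} {L} x≤a dL = begin
  map (a + b ∸_) (map (x +_) L)       ≡⟨ map-∘ L ⟨
  map (λ y → a + b ∸ (x + y)) L       ≡⟨ map-cong-local (All.map (∸-distrib-+ x≤a) dL) ⟩
  map (λ y → a ∸ x + (b ∸ y)) L       ≡⟨ map-∘ L ⟩
  map (a ∸ x +_) (map (b ∸_) L)       ∎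
  where open ≡-Reasoning

mirror-⊗ : ∀ {a b K L} → DegreeAtMost a K → DegreeAtMost b L →
  mirror (a + b) (K ⊗ L) ≡ mirror a K ⊗ mirror b L
mirror-⊗ [] dL = refl
mirror-⊗ {a} {b} {x ∷ K} {L} (x≤a ∷ dK) dL = begin
  mirror (a + b) (shift x L ++ K ⊗ L)                  ≡⟨ map-++ (a + b ∸_) (shift x L) (K ⊗ L) ⟩
  mirror (a + b) (shift x L) ++ mirror (a + b) (K ⊗ L) ≡⟨ cong₂ _++_ (mirror-shift x≤a dL) (mirror-⊗ dK dL) ⟩
  shift (a ∸ x) (mirror b L) ++ mirror a K ⊗ mirror b L ∎
  where open ≡-Reasoning

mirror-^ᴾ : ∀ {a K} n → DegreeAtMost a K → mirror (n * a) (K ^ᴾ n) ≡ mirror a K ^ᴾ n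
mirror-^ᴾ zero dK = refl
mirror-^ᴾ {a} {K} (suc n) dK =
  trans (mirror-⊗ dK (degree-^ᴾ n dK)) (cong (mirror a K ⊗_) (mirror-^ᴾ n dK))

mirror-shift-cancel : ∀ a b L → mirror (a + b) (shift a L) ≡ mirror b L
mirror-shift-cancel a b L = trans (sym (map-∘ L)) (map-cong (λ y → [m+n]∸[m+o]≡n∸o a b y) L)

mirror-raise : ∀ {b L} a → DegreeAtMost b L → mirror (a + b) L ≡ shift a (mirror b L)
mirror-raise {L = L} a dL = trans (map-cong-local (All.map (+-∸-assoc a) dL)) (map-∘ L)

-- Independence polynomials of rooted trees

sizePoly : ∀ {n} → (Vec Bool n → Bool) → Poly
sizePoly {n} p = map card (filterᵇ p (allSubsets n))

indepCoeff≡coeff : ∀ G k → indepCoeff G k ≡ coeff k (sizePoly (isIndependent G))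
indepCoeff≡coeff G k = go (allSubsets (order G))
  where
  go : ∀ L → length (filterᵇ (λ S → isIndependent G S ∧ (card S ≡ᵇ k)) L)
           ≡ coeff k (map card (filterᵇ (isIndependent G) L))
  go [] = refl
  go (S ∷ L) with isIndependent G S
  ... | false = go L
  ... | true with card S ≡ᵇ k
  ...   | true = cong suc (go L)
  ...   | false = go L

filterᵇ-map : ∀ {A B : Set} (p : B → Bool) (f : A → B) xs →
  filterᵇ p (map f xs) ≡ map f (filterᵇ (p ∘ f) xs)
filterᵇ-map p f [] = refl
filterᵇ-map p f (x ∷ xs) with p (f x)
... | true = cong (f x ∷_) (filterᵇ-map p f xs)
... | false = filterᵇ-map p f xs

sizePoly-∷ : ∀ {n} (p : Vec Bool (suc n) → Bool) →
  sizePoly p ≡ shift 1 (sizePoly (p ∘ (true ∷_))) ++ sizePoly (p ∘ (false ∷_))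
sizePoly-∷ {n} p = begin
  map card (filterᵇ p (map (true ∷_) A ++ map (false ∷_) A))
    ≡⟨ cong (map card) (filter-++ _ (map (true ∷_) A) (map (false ∷_) A)) ⟩
  map card (filterᵇ p (map (true ∷_) A) ++ filterᵇ p (map (false ∷_) A))
    ≡⟨ map-++ card (filterᵇ p (map (true ∷_) A)) _ ⟩
  map card (filterᵇ p (map (true ∷_) A)) ++ map card (filterᵇ p (map (false ∷_) A))
    ≡⟨ cong₂ (λ X Y → map card X ++ map card Y) (filterᵇ-map p (true ∷_) A) (filterᵇ-map p (false ∷_) A) ⟩
  map card (map (true ∷_) Aᵗ) ++ map card (map (false ∷_) Aᶠ)
    ≡⟨ cong₂ _++_ (trans (sym (map-∘ Aᵗ)) (map-∘ Aᵗ)) (sym (map-∘ Aᶠ)) ⟩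
  map suc (map card Aᵗ) ++ map card Aᶠ
    ∎
  where
  open ≡-Reasoning
  A = allSubsets n
  Aᵗ = filterᵇ (p ∘ (true ∷_)) A
  Aᶠ = filterᵇ (p ∘ (false ∷_)) A

card-++ᵛ : ∀ {a b} (P : Vec Bool a) (Q : Vec Bool b) → card (P ++ᵛ Q) ≡ card P + card Q
card-++ᵛ [] Q = refl
card-++ᵛ (true ∷ P) Q = cong suc (card-++ᵛ P Q)
card-++ᵛ (false ∷ P) Q = card-++ᵛ P Q

infixr 6 _⊠_
_⊠_ : ∀ {a b} → List (Vec Bool a) → List (Vec Bool b) → List (Vec Bool (a + b))
_⊠_ = cartesianProductWith _++ᵛ_

map-∷-⊠ : ∀ {a b} x (A : List (Vec Bool a)) (B : List (Vec Bool b)) →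
  map (x ∷_) A ⊠ B ≡ map (x ∷_) (A ⊠ B)
map-∷-⊠ x [] B = refl
map-∷-⊠ x (P ∷ A) B = trans (cong₂ _++_ (map-∘ B) (map-∷-⊠ x A B)) (sym (map-++ (x ∷_) (map (P ++ᵛ_) B) (A ⊠ B)))

allSubsets-+ : ∀ a b → allSubsets (a + b) ≡ allSubsets a ⊠ allSubsets b
allSubsets-+ zero b = sym (trans (++-identityʳ _) (map-id (allSubsets b)))
allSubsets-+ (suc a) b = begin
  map (true ∷_) (allSubsets (a + b)) ++ map (false ∷_) (allSubsets (a + b))
    ≡⟨ cong (λ X → map (true ∷_) X ++ map (false ∷_) X) (allSubsets-+ a b) ⟩
  map (true ∷_) (A ⊠ B) ++ map (false ∷_) (A ⊠ B)
    ≡⟨ cong₂ _++_ (map-∷-⊠ true A B) (map-∷-⊠ false A B) ⟨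
  map (true ∷_) A ⊠ B ++ map (false ∷_) A ⊠ B
    ≡⟨ cartesianProductWith-distribʳ-++ _++ᵛ_ (map (true ∷_) A) (map (false ∷_) A) B ⟨
  (map (true ∷_) A ++ map (false ∷_) A) ⊠ B
    ∎
  where
  open ≡-Reasoning
  A = allSubsets a
  B = allSubsets b

module _ {a b} {p : Vec Bool (a + b) → Bool} {p₁ : Vec Bool a → Bool} {p₂ : Vec Bool b → Bool}
         (split : ∀ P Q → p (P ++ᵛ Q) ≡ p₁ P ∧ p₂ Q) where

  private
    row-accept : ∀ P → p₁ P ≡ true → ∀ B →
      map card (filterᵇ p (map (P ++ᵛ_) B)) ≡ shift (card P) (map card (filterᵇ p₂ B))
    row-accept P p₁P [] = refl
    row-accept P p₁P (Q ∷ B) rewrite split P Q | p₁P with p₂ Q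
    ... | true = cong₂ _∷_ (card-++ᵛ P Q) (row-accept P p₁P B)
    ... | false = row-accept P p₁P B

    row-reject : ∀ P → p₁ P ≡ false → ∀ B → filterᵇ p (map (P ++ᵛ_) B) ≡ []
    row-reject P p₁P [] = refl
    row-reject P p₁P (Q ∷ B) rewrite split P Q | p₁P = row-reject P p₁P B

    sizes-⊠ : ∀ A B → map card (filterᵇ p (A ⊠ B)) ≡ map card (filterᵇ p₁ A) ⊗ map card (filterᵇ p₂ B)
    sizes-⊠ [] B = refl
    sizes-⊠ (P ∷ A) B with p₁ P in p₁P
    ... | true = begin
      map card (filterᵇ p (map (P ++ᵛ_) B ++ A ⊠ B))
        ≡⟨ cong (map card) (filter-++ _ (map (P ++ᵛ_) B) (A ⊠ B)) ⟩
      map card (filterᵇ p (map (P ++ᵛ_) B) ++ filterᵇ p (A ⊠ B))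
        ≡⟨ map-++ card (filterᵇ p (map (P ++ᵛ_) B)) _ ⟩
      map card (filterᵇ p (map (P ++ᵛ_) B)) ++ map card (filterᵇ p (A ⊠ B))
        ≡⟨ cong₂ _++_ (row-accept P p₁P B) (sizes-⊠ A B) ⟩
      shift (card P) (map card (filterᵇ p₂ B)) ++ map card (filterᵇ p₁ A) ⊗ map card (filterᵇ p₂ B)
        ∎
      where open ≡-Reasoning
    ... | false = begin
      map card (filterᵇ p (map (P ++ᵛ_) B ++ A ⊠ B))
        ≡⟨ cong (map card) (filter-++ _ (map (P ++ᵛ_) B) (A ⊠ B)) ⟩
      map card (filterᵇ p (map (P ++ᵛ_) B) ++ filterᵇ p (A ⊠ B))
        ≡⟨ cong (λ X → map card (X ++ filterᵇ p (A ⊠ B))) (row-reject P p₁P B) ⟩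
      map card (filterᵇ p (A ⊠ B))
        ≡⟨ sizes-⊠ A B ⟩
      map card (filterᵇ p₁ A) ⊗ map card (filterᵇ p₂ B)
        ∎
      where open ≡-Reasoning

  sizePoly-++ᵛ : sizePoly p ≡ sizePoly p₁ ⊗ sizePoly p₂
  sizePoly-++ᵛ = trans (cong (map card ∘ filterᵇ p) (allSubsets-+ a b)) (sizes-⊠ (allSubsets a) (allSubsets b))

independent : ∀ {n} → List (ℕ × ℕ) → Vec Bool n → Bool
independent E S = isIndependent (graph _ E) S

independent-++ : ∀ {n} E F (S : Vec Bool n) → independent (E ++ F) S ≡ independent E S ∧ independent F S
independent-++ [] F S = refl
independent-++ ((i , j) ∷ E) F S = trans (cong (ij∉S ∧_) (independent-++ E F S))
                                          (sym (∧-assoc ij∉S (independent E S) (independent F S)))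
  where ij∉S = not (i ∈ᵇ S ∧ j ∈ᵇ S)

relabel : (ℕ → ℕ) → ℕ × ℕ → ℕ × ℕ
relabel φ (i , j) = φ i , φ j

independent-relabel : ∀ {n n'} (φ : ℕ → ℕ) (S : Vec Bool n) (S' : Vec Bool n') →
  (∀ v → φ v ∈ᵇ S ≡ v ∈ᵇ S') → ∀ E → independent (map (relabel φ) E) S ≡ independent E S'
independent-relabel φ S S' φ-mem [] = refl
independent-relabel φ S S' φ-mem ((i , j) ∷ E) rewrite φ-mem i | φ-mem j =
  cong (not (i ∈ᵇ S' ∧ j ∈ᵇ S') ∧_) (independent-relabel φ S S' φ-mem E)

EdgeBelow : ℕ → ℕ × ℕ → Set
EdgeBelow n (i , j) = i < n × j < n

∈ᵇ-++ᵛˡ : ∀ {a b} (P : Vec Bool a) (Q : Vec Bool b) {i} → i < a → i ∈ᵇ (P ++ᵛ Q) ≡ i ∈ᵇ P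
∈ᵇ-++ᵛˡ (x ∷ P) Q {zero} i<a = refl
∈ᵇ-++ᵛˡ (x ∷ P) Q {suc i} (s≤s i<a) = ∈ᵇ-++ᵛˡ P Q i<a

∈ᵇ-++ᵛʳ : ∀ {a b} (P : Vec Bool a) (Q : Vec Bool b) w → (a + w) ∈ᵇ (P ++ᵛ Q) ≡ w ∈ᵇ Q
∈ᵇ-++ᵛʳ [] Q w = refl
∈ᵇ-++ᵛʳ (x ∷ P) Q w = ∈ᵇ-++ᵛʳ P Q w

independent-++ᵛ : ∀ {a b} (P : Vec Bool a) (Q : Vec Bool b) {E} →
  All (EdgeBelow a) E → independent E (P ++ᵛ Q) ≡ independent E P
independent-++ᵛ P Q [] = refl
independent-++ᵛ P Q {(i , j) ∷ E} ((i<a , j<a) ∷ below)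
  rewrite ∈ᵇ-++ᵛˡ P Q i<a | ∈ᵇ-++ᵛˡ P Q j<a =
  cong (not (i ∈ᵇ P ∧ j ∈ᵇ P) ∧_) (independent-++ᵛ P Q below)

offset-base : ∀ (φ : ℕ → ℕ) {c c'} → (∀ i → φ (c + i) ≡ c' + i) → φ c ≡ c'
offset-base φ {c} {c'} φ-offset = trans (cong φ (sym (+-identityʳ c))) (trans (φ-offset 0) (+-identityʳ c'))

mutual
  treeEdges-relabel : ∀ (φ : ℕ → ℕ) {c c'} → (∀ i → φ (c + i) ≡ c' + i) → ∀ t →
    treeEdges c' t ≡ map (relabel φ) (treeEdges c t)
  treeEdges-relabel φ {c} {c'} φ-offset (node ts) = childEdges-relabel φ (offset-base φ φ-offset)
    (λ i → trans (cong φ (sym (+-suc c i))) (trans (φ-offset (suc i)) (+-suc c' i))) ts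

  childEdges-relabel : ∀ (φ : ℕ → ℕ) {p p' c c'} → φ p ≡ p' → (∀ i → φ (c + i) ≡ c' + i) → ∀ ts →
    childEdges p' c' ts ≡ map (relabel φ) (childEdges p c ts)
  childEdges-relabel φ φp φ-offset [] = refl
  childEdges-relabel φ {p} {p'} {c} {c'} φp φ-offset (t ∷ ts) =
    cong₂ _∷_ (cong₂ _,_ (sym φp) (sym (offset-base φ φ-offset)))
      (trans (cong₂ _++_ (treeEdges-relabel φ φ-offset t) (childEdges-relabel φ φp φ-offset′ ts))
             (sym (map-++ (relabel φ) (treeEdges c t) (childEdges p (c + size t) ts))))
    where
    φ-offset′ : ∀ i → φ (c + size t + i) ≡ c' + size t + i
    φ-offset′ i = trans (cong φ (+-assoc c (size t) i)) (trans (φ-offset (size t + i)) (sym (+-assoc c' (size t) i)))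

size-pos : ∀ t → 0 < size t
size-pos (node ts) = s≤s z≤n

mutual
  treeEdges-below : ∀ {n} c t → c + size t ≤ n → All (EdgeBelow n) (treeEdges c t)
  treeEdges-below c (node ts) c+size≤n =
    childEdges-below c (suc c) ts (≤-trans (m<m+n c (s≤s z≤n)) c+size≤n)
      (≤-trans (≤-reflexive (sym (+-suc c (sizes ts)))) c+size≤n)

  childEdges-below : ∀ {n} p c ts → p < n → c + sizes ts ≤ n → All (EdgeBelow n) (childEdges p c ts)
  childEdges-below p c [] p<n c+sizes≤n = []
  childEdges-below p c (t ∷ ts) p<n c+sizes≤n =
    (p<n , ≤-trans (m<m+n c (≤-trans (size-pos t) (m≤m+n (size t) (sizes ts)))) c+sizes≤n)
    ∷ ++⁺ (treeEdges-below c t (≤-trans (+-monoʳ-≤ c (m≤m+n (size t) (sizes ts))) c+sizes≤n))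
          (childEdges-below p (c + size t) ts p<n (≤-trans (≤-reflexive (+-assoc c (size t) (sizes ts))) c+sizes≤n))

-- The edges inside t and those joining the root to the other subtrees are, up to relabelling,
-- the edges of the trees t and node ts.
independent-node-∷ : ∀ cs ts b p (P : Vec Bool (sizes cs)) (Q : Vec Bool (sizes ts)) →
  isIndependent (toGraph (node (node cs ∷ ts))) (b ∷ (p ∷ P) ++ᵛ Q)
  ≡ (not (b ∧ p) ∧ isIndependent (toGraph (node cs)) (p ∷ P)) ∧ isIndependent (toGraph (node ts)) (b ∷ Q)
independent-node-∷ cs ts b p P Q = begin
  not (b ∧ p) ∧ independent (treeEdges 1 t ++ childEdges 0 (1 + size t) ts) S
    ≡⟨ cong (not (b ∧ p) ∧_) (independent-++ (treeEdges 1 t) (childEdges 0 (1 + size t) ts) S) ⟩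
  not (b ∧ p) ∧ (independent (treeEdges 1 t) S ∧ independent (childEdges 0 (1 + size t) ts) S)
    ≡⟨ cong₂ (λ u v → not (b ∧ p) ∧ (u ∧ v)) subtree siblings ⟩
  not (b ∧ p) ∧ (independent (treeEdges 0 t) (p ∷ P) ∧ independent (childEdges 0 1 ts) (b ∷ Q))
    ≡⟨ ∧-assoc (not (b ∧ p)) _ _ ⟨
  (not (b ∧ p) ∧ independent (treeEdges 0 t) (p ∷ P)) ∧ independent (childEdges 0 1 ts) (b ∷ Q)
    ∎
  where
  open ≡-Reasoning
  t = node cs
  S = b ∷ (p ∷ P) ++ᵛ Q

  subtree : independent (treeEdges 1 t) S ≡ independent (treeEdges 0 t) (p ∷ P)
  subtree = begin
    independent (treeEdges 1 t) S
      ≡⟨ cong (λ E → independent E S) (treeEdges-relabel suc (λ _ → refl) t) ⟩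
    independent (map (relabel suc) (treeEdges 0 t)) S
      ≡⟨ independent-relabel suc S ((p ∷ P) ++ᵛ Q) (λ _ → refl) (treeEdges 0 t) ⟩
    independent (treeEdges 0 t) ((p ∷ P) ++ᵛ Q)
      ≡⟨ independent-++ᵛ (p ∷ P) Q (treeEdges-below 0 t ≤-refl) ⟩
    independent (treeEdges 0 t) (p ∷ P)
      ∎

  skip-t : ℕ → ℕ
  skip-t zero = zero
  skip-t (suc w) = suc (size t + w)

  siblings : independent (childEdges 0 (1 + size t) ts) S ≡ independent (childEdges 0 1 ts) (b ∷ Q)
  siblings = begin
    independent (childEdges 0 (1 + size t) ts) S
      ≡⟨ cong (λ E → independent E S) (childEdges-relabel skip-t refl (λ _ → refl) ts) ⟩
    independent (map (relabel skip-t) (childEdges 0 1 ts)) S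
      ≡⟨ independent-relabel skip-t S (b ∷ Q) skip-t-mem (childEdges 0 1 ts) ⟩
    independent (childEdges 0 1 ts) (b ∷ Q)
      ∎
    where
    skip-t-mem : ∀ v → skip-t v ∈ᵇ S ≡ v ∈ᵇ (b ∷ Q)
    skip-t-mem zero = refl
    skip-t-mem (suc w) = ∈ᵇ-++ᵛʳ (p ∷ P) Q w

mutual
  indPoly : Tree → Poly
  indPoly (node ts) = shift 1 (indPolyGrandchildren ts) ++ indPolyForest ts

  indPolyForest : List Tree → Poly
  indPolyForest [] = 0 ∷ []
  indPolyForest (t ∷ ts) = indPoly t ⊗ indPolyForest ts

  indPolyGrandchildren : List Tree → Poly
  indPolyGrandchildren [] = 0 ∷ []
  indPolyGrandchildren (node cs ∷ ts) = indPolyForest cs ⊗ indPolyGrandchildren ts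

sizePoly-reject : ∀ n → sizePoly {n} (λ _ → false) ≡ []
sizePoly-reject n = cong (map card) (filter-none (T? ∘ λ _ → false) (All.universal (λ _ → λ ()) (allSubsets n)))

mutual
  sizePoly-tree : ∀ t → sizePoly (isIndependent (toGraph t)) ≡ indPoly t
  sizePoly-tree (node ts) =
    trans (sizePoly-∷ _) (cong₂ (λ X Y → shift 1 X ++ Y) (sizePoly-rootIn ts) (sizePoly-rootOut ts))

  sizePoly-rootOut : ∀ ts → sizePoly (isIndependent (toGraph (node ts)) ∘ (false ∷_)) ≡ indPolyForest ts
  sizePoly-rootOut [] = refl
  sizePoly-rootOut (node cs ∷ ts) =
    trans (sizePoly-++ᵛ split) (cong₂ _⊗_ (sizePoly-tree (node cs)) (sizePoly-rootOut ts))
    where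
    split : ∀ P Q → isIndependent (toGraph (node (node cs ∷ ts))) (false ∷ P ++ᵛ Q)
                  ≡ isIndependent (toGraph (node cs)) P ∧ isIndependent (toGraph (node ts)) (false ∷ Q)
    split (p ∷ P) Q = independent-node-∷ cs ts false p P Q

  sizePoly-rootIn : ∀ ts → sizePoly (isIndependent (toGraph (node ts)) ∘ (true ∷_)) ≡ indPolyGrandchildren ts
  sizePoly-rootIn [] = refl
  sizePoly-rootIn (node cs ∷ ts) =
    trans (sizePoly-++ᵛ split) (cong₂ _⊗_ child-excluded (sizePoly-rootIn ts))
    where
    excludingRoot : Vec Bool (suc (sizes cs)) → Bool
    excludingRoot (p ∷ P) = not p ∧ isIndependent (toGraph (node cs)) (p ∷ P)

    split : ∀ P Q → isIndependent (toGraph (node (node cs ∷ ts))) (true ∷ P ++ᵛ Q)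
                  ≡ excludingRoot P ∧ isIndependent (toGraph (node ts)) (true ∷ Q)
    split (p ∷ P) Q = independent-node-∷ cs ts true p P Q

    child-excluded : sizePoly excludingRoot ≡ indPolyForest cs
    child-excluded = begin
      sizePoly excludingRoot
        ≡⟨ sizePoly-∷ excludingRoot ⟩
      shift 1 (sizePoly (λ _ → false)) ++ sizePoly (excludingRoot ∘ (false ∷_))
        ≡⟨ cong (λ X → shift 1 X ++ sizePoly (excludingRoot ∘ (false ∷_))) (sizePoly-reject (sizes cs)) ⟩
      sizePoly (excludingRoot ∘ (false ∷_))
        ≡⟨ sizePoly-rootOut cs ⟩
      indPolyForest cs
        ∎
      where open ≡-Reasoning

indepCoeff-tree : ∀ t k → indepCoeff (toGraph t) k ≡ coeff k (indPoly t)
indepCoeff-tree t k = trans (indepCoeff≡coeff (toGraph t) k) (cong (coeff k) (sizePoly-tree t))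

indPolyForest-replicate : ∀ n t → indPolyForest (replicate n t) ≡ indPoly t ^ᴾ n
indPolyForest-replicate zero t = refl
indPolyForest-replicate (suc n) t = cong (indPoly t ⊗_) (indPolyForest-replicate n t)

indPolyGrandchildren-replicate : ∀ n cs → indPolyGrandchildren (replicate n (node cs)) ≡ indPolyForest cs ^ᴾ n
indPolyGrandchildren-replicate zero cs = refl
indPolyGrandchildren-replicate (suc n) cs = cong (indPolyForest cs ⊗_) (indPolyGrandchildren-replicate n cs)

S₂ : ℕ → Tree
S₂ t = node (replicate t P2)

indPoly-S₂ : ∀ t → indPoly (S₂ t) ≡ shift 1 ((1 ∷ 0 ∷ []) ^ᴾ t) ++ (1 ∷ 1 ∷ 0 ∷ []) ^ᴾ t
indPoly-S₂ t = cong₂ (λ X Y → shift 1 X ++ Y)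
  (indPolyGrandchildren-replicate t (node [] ∷ [])) (indPolyForest-replicate t P2)

indPoly-T : ∀ t → indPoly (T 3 t) ≡ shift 1 ((1 ∷ 1 ∷ 0 ∷ []) ^ᴾ t ^ᴾ 3) ++ indPoly (S₂ t) ^ᴾ 3
indPoly-T t = cong₂ (λ X Y → shift 1 X ++ Y)
  (trans (indPolyGrandchildren-replicate 3 (replicate t P2)) (cong (_^ᴾ 3) (indPolyForest-replicate t P2)))
  (indPolyForest-replicate 3 (S₂ t))

indPoly-TG : ∀ m t → indPoly (TG m t) ≡ shift 1 (indPoly (S₂ t) ^ᴾ 3 ^ᴾ m) ++ (1 ∷ 0 ∷ []) ⊗ indPoly (T 3 t) ^ᴾ m
indPoly-TG m t = cong₂ (λ X Y → shift 1 X ++ (1 ∷ 0 ∷ []) ⊗ Y)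
  (trans (⊗-identityˡ _) (trans (indPolyGrandchildren-replicate m (replicate 3 (S₂ t)))
                                (cong (_^ᴾ m) (indPolyForest-replicate 3 (S₂ t)))))
  (indPolyForest-replicate m (T 3 t))

recipS₂ : ℕ → Poly
recipS₂ t = (0 ∷ 1 ∷ []) ^ᴾ t ++ shift 1 ((0 ∷ 0 ∷ 1 ∷ []) ^ᴾ t)

recipT : ℕ → Poly
recipT t = shift 2 ((0 ∷ 0 ∷ 1 ∷ []) ^ᴾ t ^ᴾ 3) ++ recipS₂ t ^ᴾ 3

recipTG : ℕ → ℕ → Poly
recipTG m t = recipS₂ t ^ᴾ 3 ^ᴾ m ++ (0 ∷ 1 ∷ []) ⊗ recipT t ^ᴾ m

degTG : ℕ → ℕ → ℕ
degTG m t = 1 + m * (3 * (1 + t))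

private
  degree-^ᴾ-linear : ∀ {K} t → DegreeAtMost 1 K → DegreeAtMost t (K ^ᴾ t)
  degree-^ᴾ-linear {K} t dK = subst (λ N → DegreeAtMost N (K ^ᴾ t)) (*-identityʳ t) (degree-^ᴾ t dK)

  mirror-^ᴾ-linear : ∀ {K} t → DegreeAtMost 1 K → mirror t (K ^ᴾ t) ≡ mirror 1 K ^ᴾ t
  mirror-^ᴾ-linear {K} t dK = subst (λ N → mirror N (K ^ᴾ t) ≡ mirror 1 K ^ᴾ t) (*-identityʳ t) (mirror-^ᴾ t dK)

  degree-x+1 : DegreeAtMost 1 (1 ∷ 0 ∷ [])
  degree-x+1 = s≤s z≤n ∷ z≤n ∷ []

  degree-2x+1 : DegreeAtMost 1 (1 ∷ 1 ∷ 0 ∷ [])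
  degree-2x+1 = s≤s z≤n ∷ degree-x+1

  3[1+t]≡2+[1+3t] : ∀ t → 3 * (1 + t) ≡ 2 + (1 + 3 * t)
  3[1+t]≡2+[1+3t] = solve-∀

degree-S₂ : ∀ t → DegreeAtMost (1 + t) (indPoly (S₂ t))
degree-S₂ t = subst (DegreeAtMost (1 + t)) (sym (indPoly-S₂ t))
  (++⁺ (degree-shift 1 (degree-^ᴾ-linear t degree-x+1)) (degree-weaken (n≤1+n t) (degree-^ᴾ-linear t degree-2x+1)))

degree-T : ∀ t → DegreeAtMost (3 * (1 + t)) (indPoly (T 3 t))
degree-T t = subst (DegreeAtMost (3 * (1 + t))) (sym (indPoly-T t))
  (++⁺ (subst (λ N → DegreeAtMost N (shift 1 ((1 ∷ 1 ∷ 0 ∷ []) ^ᴾ t ^ᴾ 3))) (sym (3[1+t]≡2+[1+3t] t))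
          (degree-weaken (m≤n+m _ 2) (degree-shift 1 (degree-^ᴾ 3 (degree-^ᴾ-linear t degree-2x+1)))))
       (degree-^ᴾ 3 (degree-S₂ t)))

degree-TG : ∀ m t → DegreeAtMost (degTG m t) (indPoly (TG m t))
degree-TG m t = subst (DegreeAtMost (degTG m t)) (sym (indPoly-TG m t))
  (++⁺ (degree-shift 1 (degree-^ᴾ m (degree-^ᴾ 3 (degree-S₂ t))))
       (degree-⊗ degree-x+1 (degree-^ᴾ m (degree-T t))))

mirror-S₂ : ∀ t → mirror (1 + t) (indPoly (S₂ t)) ≡ recipS₂ t
mirror-S₂ t = begin
  mirror (1 + t) (indPoly (S₂ t))
    ≡⟨ cong (mirror (1 + t)) (indPoly-S₂ t) ⟩
  mirror (1 + t) (shift 1 X ++ Y)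
    ≡⟨ map-++ (1 + t ∸_) (shift 1 X) Y ⟩
  mirror (1 + t) (shift 1 X) ++ mirror (1 + t) Y
    ≡⟨ cong₂ _++_ (mirror-shift-cancel 1 t X) (mirror-raise 1 (degree-^ᴾ-linear t degree-2x+1)) ⟩
  mirror t X ++ shift 1 (mirror t Y)
    ≡⟨ cong₂ (λ U V → U ++ shift 1 V) (mirror-^ᴾ-linear t degree-x+1) (mirror-^ᴾ-linear t degree-2x+1) ⟩
  recipS₂ t
    ∎
  where
  open ≡-Reasoning
  X = (1 ∷ 0 ∷ []) ^ᴾ t
  Y = (1 ∷ 1 ∷ 0 ∷ []) ^ᴾ t

mirror-T : ∀ t → mirror (3 * (1 + t)) (indPoly (T 3 t)) ≡ recipT t
mirror-T t = begin
  mirror (3 * (1 + t)) (indPoly (T 3 t))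
    ≡⟨ cong (mirror (3 * (1 + t))) (indPoly-T t) ⟩
  mirror (3 * (1 + t)) (shift 1 X ++ Z)
    ≡⟨ map-++ (3 * (1 + t) ∸_) (shift 1 X) Z ⟩
  mirror (3 * (1 + t)) (shift 1 X) ++ mirror (3 * (1 + t)) Z
    ≡⟨ cong (λ N → mirror N (shift 1 X) ++ mirror (3 * (1 + t)) Z) (3[1+t]≡2+[1+3t] t) ⟩
  mirror (2 + (1 + 3 * t)) (shift 1 X) ++ mirror (3 * (1 + t)) Z
    ≡⟨ cong (_++ mirror (3 * (1 + t)) Z) (mirror-raise 2 (degree-shift 1 dX)) ⟩
  shift 2 (mirror (1 + 3 * t) (shift 1 X)) ++ mirror (3 * (1 + t)) Z
    ≡⟨ cong₂ (λ U V → shift 2 U ++ V) (mirror-shift-cancel 1 (3 * t) X) (mirror-^ᴾ 3 (degree-S₂ t)) ⟩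
  shift 2 (mirror (3 * t) X) ++ mirror (1 + t) (indPoly (S₂ t)) ^ᴾ 3
    ≡⟨ cong₂ (λ U V → shift 2 U ++ V ^ᴾ 3)
         (trans (mirror-^ᴾ 3 dY) (cong (_^ᴾ 3) (mirror-^ᴾ-linear t degree-2x+1))) (mirror-S₂ t) ⟩
  recipT t
    ∎
  where
  open ≡-Reasoning
  X = (1 ∷ 1 ∷ 0 ∷ []) ^ᴾ t ^ᴾ 3
  Z = indPoly (S₂ t) ^ᴾ 3
  dY : DegreeAtMost t ((1 ∷ 1 ∷ 0 ∷ []) ^ᴾ t)
  dY = degree-^ᴾ-linear t degree-2x+1
  dX : DegreeAtMost (3 * t) X
  dX = degree-^ᴾ 3 dY

mirror-TG : ∀ m t → mirror (degTG m t) (indPoly (TG m t)) ≡ recipTG m t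
mirror-TG m t = begin
  mirror (degTG m t) (indPoly (TG m t))
    ≡⟨ cong (mirror (degTG m t)) (indPoly-TG m t) ⟩
  mirror (degTG m t) (shift 1 X ++ Y)
    ≡⟨ map-++ (degTG m t ∸_) (shift 1 X) Y ⟩
  mirror (degTG m t) (shift 1 X) ++ mirror (degTG m t) Y
    ≡⟨ cong₂ _++_ (mirror-shift-cancel 1 _ X) (mirror-⊗ degree-x+1 (degree-^ᴾ m (degree-T t))) ⟩
  mirror (m * (3 * (1 + t))) X ++ (0 ∷ 1 ∷ []) ⊗ mirror (m * (3 * (1 + t))) (indPoly (T 3 t) ^ᴾ m)
    ≡⟨ cong₂ (λ U V → U ++ (0 ∷ 1 ∷ []) ⊗ V) (mirror-^ᴾ m (degree-^ᴾ 3 (degree-S₂ t))) (mirror-^ᴾ m (degree-T t)) ⟩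
  mirror (3 * (1 + t)) (indPoly (S₂ t) ^ᴾ 3) ^ᴾ m ++ (0 ∷ 1 ∷ []) ⊗ mirror (3 * (1 + t)) (indPoly (T 3 t)) ^ᴾ m
    ≡⟨ cong₂ (λ U V → U ^ᴾ m ++ (0 ∷ 1 ∷ []) ⊗ V ^ᴾ m)
         (trans (mirror-^ᴾ 3 (degree-S₂ t)) (cong (_^ᴾ 3) (mirror-S₂ t))) (mirror-T t) ⟩
  recipTG m t
    ∎
  where
  open ≡-Reasoning
  X = indPoly (S₂ t) ^ᴾ 3 ^ᴾ m
  Y = (1 ∷ 0 ∷ []) ⊗ indPoly (T 3 t) ^ᴾ m

indepCoeff-TG : ∀ m t j → j ≤ degTG m t → indepCoeff (toGraph (TG m t)) (degTG m t ∸ j) ≡ coeff j (recipTG m t)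
indepCoeff-TG m t j j≤deg = begin
  indepCoeff (toGraph (TG m t)) (degTG m t ∸ j)          ≡⟨ indepCoeff-tree (TG m t) (degTG m t ∸ j) ⟩
  coeff (degTG m t ∸ j) (indPoly (TG m t))                ≡⟨ coeff-mirror (degree-TG m t) j≤deg ⟨
  coeff j (mirror (degTG m t) (indPoly (TG m t)))         ≡⟨ cong (coeff j) (mirror-TG m t) ⟩
  coeff j (recipTG m t)                                   ∎
  where open ≡-Reasoning

n<2^n : ∀ n → n < 2 ^ n
n<2^n zero = s≤s z≤n
n<2^n (suc n) = begin-strict
  suc n          ≡⟨ +-comm 1 n ⟩
  n + 1          <⟨ +-monoˡ-< 1 (n<2^n n) ⟩
  2 ^ n + 1      ≤⟨ +-monoʳ-≤ (2 ^ n) (≤-trans (m^n>0 2 n) (m≤m+n (2 ^ n) 0)) ⟩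
  2 ^ suc n      ∎
  where open ≤-Reasoning

^-distribʳ-* : ∀ m n k → (m * n) ^ k ≡ m ^ k * n ^ k
^-distribʳ-* m n zero = refl
^-distribʳ-* m n (suc k) =
  trans (cong (m * n *_) (^-distribʳ-* m n k)) ([m*n]*[o*p]≡[m*o]*[n*p] m n (m ^ k) (n ^ k))

-- (1 + 1/a)^n (1 - n/a) ≤ 1, cleared of denominators.
[1+a]^n*[a∸n]≤a^[1+n] : ∀ a n → suc a ^ n * (a ∸ n) ≤ a ^ suc n
[1+a]^n*[a∸n]≤a^[1+n] a zero = ≤-reflexive (trans (+-identityʳ a) (sym (*-identityʳ a)))
[1+a]^n*[a∸n]≤a^[1+n] a (suc n) = begin
  suc a * suc a ^ n * (a ∸ suc n)      ≡⟨ xy∙z≈y∙xz (suc a) (suc a ^ n) (a ∸ suc n) ⟩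
  suc a ^ n * (suc a * (a ∸ suc n))    ≡⟨ cong (λ k → suc a ^ n * (suc a * k)) (pred[m∸n]≡m∸[1+n] a n) ⟨
  suc a ^ n * (suc a * pred (a ∸ n))   ≤⟨ *-monoʳ-≤ (suc a ^ n) ([1+a]*pred[k]≤a*k (a ∸ n) (m∸n≤m a n)) ⟩
  suc a ^ n * (a * (a ∸ n))            ≡⟨ x∙yz≈y∙xz (suc a ^ n) a (a ∸ n) ⟩
  a * (suc a ^ n * (a ∸ n))            ≤⟨ *-monoʳ-≤ a ([1+a]^n*[a∸n]≤a^[1+n] a n) ⟩
  a * a ^ suc n                        ∎
  where
  open ≤-Reasoning
  [1+a]*pred[k]≤a*k : ∀ k → k ≤ a → suc a * pred k ≤ a * k
  [1+a]*pred[k]≤a*k zero _ = ≤-refl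
  [1+a]*pred[k]≤a*k (suc j) j<a = ≤-trans (+-monoˡ-≤ (a * j) (<⇒≤ j<a)) (≤-reflexive (sym (*-suc a j)))

[1+a]^n≤2*a^n : ∀ {a} n .{{_ : NonZero a}} → 2 * n ≤ a → suc a ^ n ≤ 2 * a ^ n
[1+a]^n≤2*a^n {a} n 2n≤a = *-cancelʳ-≤ _ _ a (begin
  suc a ^ n * a                  ≤⟨ *-monoʳ-≤ (suc a ^ n) a≤2[a∸n] ⟩
  suc a ^ n * (2 * (a ∸ n))      ≡⟨ x∙yz≈y∙xz (suc a ^ n) 2 (a ∸ n) ⟩
  2 * (suc a ^ n * (a ∸ n))      ≤⟨ *-monoʳ-≤ 2 ([1+a]^n*[a∸n]≤a^[1+n] a n) ⟩
  2 * (a * a ^ n)                ≡⟨ cong (2 *_) (*-comm a (a ^ n)) ⟩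
  2 * (a ^ n * a)                ≡⟨ *-assoc 2 (a ^ n) a ⟨
  2 * a ^ n * a                  ∎)
  where
  open ≤-Reasoning
  n+n≤a : n + n ≤ a
  n+n≤a = ≤-trans (≤-reflexive (cong (n +_) (sym (+-identityʳ n)))) 2n≤a
  a≤2[a∸n] : a ≤ 2 * (a ∸ n)
  a≤2[a∸n] = begin
    a               ≡⟨ m∸n+n≡m (m+n≤o⇒n≤o n n+n≤a) ⟨
    (a ∸ n) + n     ≤⟨ +-monoʳ-≤ (a ∸ n) (≤-trans (m+n≤o⇒m≤o∸n n n+n≤a) (m≤m+n (a ∸ n) 0)) ⟩
    2 * (a ∸ n)     ∎

⌊1+n*2/2⌋≡n : ∀ n → ⌊ suc (n * 2) /2⌋ ≡ n
⌊1+n*2/2⌋≡n zero = refl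
⌊1+n*2/2⌋≡n (suc n) = cong suc (⌊1+n*2/2⌋≡n n)

⌊m/2⌋+⌊n/2⌋≤⌊m+n/2⌋ : ∀ m n → ⌊ m /2⌋ + ⌊ n /2⌋ ≤ ⌊ m + n /2⌋
⌊m/2⌋+⌊n/2⌋≤⌊m+n/2⌋ zero n = ≤-refl
⌊m/2⌋+⌊n/2⌋≤⌊m+n/2⌋ (suc zero) n = ⌊n/2⌋-mono (n≤1+n n)
⌊m/2⌋+⌊n/2⌋≤⌊m+n/2⌋ (suc (suc m)) n = s≤s (⌊m/2⌋+⌊n/2⌋≤⌊m+n/2⌋ m n)

-- Weighted coefficient sums

module WeightedSum (W : ℕ → ℕ) .{{_ : NonZero (W 0)}}
                   (W-submult : ∀ a b → W (a + b) * W 0 ≤ W a * W b) where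

  Φ : Poly → ℕ
  Φ K = sum (map W K)

  Φ-++ : ∀ K L → Φ (K ++ L) ≡ Φ K + Φ L
  Φ-++ K L = trans (cong sum (map-++ W K L)) (sum-++ (map W K) (map W L))

  coeff*W≤Φ : ∀ j K → coeff j K * W j ≤ Φ K
  coeff*W≤Φ j [] = z≤n
  coeff*W≤Φ j (x ∷ K) with x ≟ j
  ... | yes refl = begin
    coeff x (x ∷ K) * W x   ≡⟨ cong (_* W x) (coeff-∷-≡ x K) ⟩
    W x + coeff x K * W x   ≤⟨ +-monoʳ-≤ (W x) (coeff*W≤Φ x K) ⟩
    W x + Φ K               ∎
    where open ≤-Reasoning
  ... | no x≢j = begin
    coeff j (x ∷ K) * W j   ≡⟨ cong (_* W j) (coeff-∷-≢ K x≢j) ⟩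
    coeff j K * W j         ≤⟨ coeff*W≤Φ j K ⟩
    Φ K                     ≤⟨ m≤n+m (Φ K) (W x) ⟩
    W x + Φ K               ∎
    where open ≤-Reasoning

  Φ-shift : ∀ a K → Φ (shift a K) * W 0 ≤ W a * Φ K
  Φ-shift a [] = ≤-reflexive (sym (*-zeroʳ (W a)))
  Φ-shift a (y ∷ K) = begin
    (W (a + y) + Φ (shift a K)) * W 0      ≡⟨ *-distribʳ-+ (W 0) (W (a + y)) _ ⟩
    W (a + y) * W 0 + Φ (shift a K) * W 0  ≤⟨ +-mono-≤ (W-submult a y) (Φ-shift a K) ⟩
    W a * W y + W a * Φ K                  ≡⟨ *-distribˡ-+ (W a) (W y) (Φ K) ⟨
    W a * (W y + Φ K)                      ∎
    where open ≤-Reasoning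

  Φ-⊗ : ∀ K L → Φ (K ⊗ L) * W 0 ≤ Φ K * Φ L
  Φ-⊗ [] L = z≤n
  Φ-⊗ (x ∷ K) L = begin
    Φ (shift x L ++ K ⊗ L) * W 0                  ≡⟨ cong (_* W 0) (Φ-++ (shift x L) (K ⊗ L)) ⟩
    (Φ (shift x L) + Φ (K ⊗ L)) * W 0             ≡⟨ *-distribʳ-+ (W 0) (Φ (shift x L)) (Φ (K ⊗ L)) ⟩
    Φ (shift x L) * W 0 + Φ (K ⊗ L) * W 0         ≤⟨ +-mono-≤ (Φ-shift x L) (Φ-⊗ K L) ⟩
    W x * Φ L + Φ K * Φ L                         ≡⟨ *-distribʳ-+ (Φ L) (W x) (Φ K) ⟨
    (W x + Φ K) * Φ L                             ∎
    where open ≤-Reasoning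

  -- Φ K ≤ (c / d) · W 0, with the fraction kept as a pair to stay in ℕ.
  infix 4 _≼_/_
  record _≼_/_ (K : Poly) (c d : ℕ) : Set where
    constructor weighted≤
    field Φ*d≤c*W0 : Φ K * d ≤ c * W 0

  ≼-weaken : ∀ {K c d c′ d′} .{{_ : NonZero d}} → K ≼ c / d → c * d′ ≤ c′ * d → K ≼ c′ / d′
  ≼-weaken {K} {c} {d} {c′} {d′} (weighted≤ K≼) cd′≤c′d = weighted≤ (*-cancelʳ-≤ _ _ d (begin
    Φ K * d′ * d      ≡⟨ xy∙z≈xz∙y (Φ K) d′ d ⟩
    Φ K * d * d′      ≤⟨ *-monoˡ-≤ d′ K≼ ⟩
    c * W 0 * d′      ≡⟨ xy∙z≈xz∙y c (W 0) d′ ⟩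
    c * d′ * W 0      ≤⟨ *-monoˡ-≤ (W 0) cd′≤c′d ⟩
    c′ * d * W 0      ≡⟨ xy∙z≈xz∙y c′ d (W 0) ⟩
    c′ * W 0 * d      ∎))
    where open ≤-Reasoning

  ≼-++ : ∀ {K L c c′ d} → K ≼ c / d → L ≼ c′ / d → K ++ L ≼ c + c′ / d
  ≼-++ {K} {L} {c} {c′} {d} (weighted≤ K≼) (weighted≤ L≼) = weighted≤ (begin
    Φ (K ++ L) * d           ≡⟨ cong (_* d) (Φ-++ K L) ⟩
    (Φ K + Φ L) * d          ≡⟨ *-distribʳ-+ d (Φ K) (Φ L) ⟩
    Φ K * d + Φ L * d        ≤⟨ +-mono-≤ K≼ L≼ ⟩
    c * W 0 + c′ * W 0       ≡⟨ *-distribʳ-+ (W 0) c c′ ⟨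
    (c + c′) * W 0           ∎)
    where open ≤-Reasoning

  private
    ≼-product : ∀ P x y c c′ d d′ → Φ P * W 0 ≤ x * y → x * d ≤ c * W 0 → y * d′ ≤ c′ * W 0 →
      P ≼ c * c′ / (d * d′)
    ≼-product P x y c c′ d d′ ΦP≤xy x≤ y≤ = weighted≤ (*-cancelʳ-≤ _ _ (W 0) (begin
      Φ P * (d * d′) * W 0      ≡⟨ xy∙z≈xz∙y (Φ P) (d * d′) (W 0) ⟩
      Φ P * W 0 * (d * d′)      ≤⟨ *-monoˡ-≤ (d * d′) ΦP≤xy ⟩
      x * y * (d * d′)          ≡⟨ [m*n]*[o*p]≡[m*o]*[n*p] x y d d′ ⟩
      (x * d) * (y * d′)        ≤⟨ *-mono-≤ x≤ y≤ ⟩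
      (c * W 0) * (c′ * W 0)    ≡⟨ [m*n]*[o*p]≡[m*o]*[n*p] c (W 0) c′ (W 0) ⟩
      (c * c′) * (W 0 * W 0)    ≡⟨ *-assoc (c * c′) (W 0) (W 0) ⟨
      c * c′ * W 0 * W 0        ∎))
      where open ≤-Reasoning

  ≼-⊗ : ∀ {K L c c′ d d′} → K ≼ c / d → L ≼ c′ / d′ → K ⊗ L ≼ c * c′ / (d * d′)
  ≼-⊗ {K} {L} {c} {c′} {d} {d′} (weighted≤ K≼) (weighted≤ L≼) =
    ≼-product (K ⊗ L) (Φ K) (Φ L) c c′ d d′ (Φ-⊗ K L) K≼ L≼

  ≼-shift : ∀ {K c d} a x → W a * x ≡ W 0 → K ≼ c / d → shift a K ≼ c / (x * d)
  ≼-shift {K} {c} {d} a x Wa*x≡W0 (weighted≤ K≼) =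
    subst (λ c″ → shift a K ≼ c″ / (x * d)) (*-identityˡ c)
      (≼-product (shift a K) (W a) (Φ K) 1 c x d (Φ-shift a K) (≤-reflexive (trans Wa*x≡W0 (sym (*-identityˡ (W 0))))) K≼)

  ≼-monomial : ∀ {a x} → W a * x ≡ W 0 → (a ∷ []) ≼ 1 / x
  ≼-monomial {a} {x} Wa*x≡W0 = weighted≤ (≤-reflexive (begin
    (W a + 0) * x  ≡⟨ cong (_* x) (+-identityʳ (W a)) ⟩
    W a * x        ≡⟨ Wa*x≡W0 ⟩
    W 0            ≡⟨ *-identityˡ (W 0) ⟨
    1 * W 0        ∎))
    where open ≡-Reasoning

  ≼-integral : ∀ {K c d c′} .{{_ : NonZero d}} → K ≼ c / d → c ≤ c′ * d → K ≼ c′ / 1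
  ≼-integral {c = c} K≼ c≤c′d = ≼-weaken K≼ (≤-trans (≤-reflexive (*-identityʳ c)) c≤c′d)

  ≼-one : (0 ∷ []) ≼ 1 / 1
  ≼-one = weighted≤ (≤-reflexive (*-identityʳ (W 0 + 0)))

  ≼-^ᴾ : ∀ {K c d} n → K ≼ c / d → K ^ᴾ n ≼ c ^ n / d ^ n
  ≼-^ᴾ zero K≼ = ≼-one
  ≼-^ᴾ (suc n) K≼ = ≼-⊗ K≼ (≼-^ᴾ n K≼)

  ≼-^ᴾ-integral : ∀ {K c} n → K ≼ c / 1 → K ^ᴾ n ≼ c ^ n / 1
  ≼-^ᴾ-integral {K} {c} n K≼ = subst (K ^ᴾ n ≼ c ^ n /_) (^-zeroˡ n) (≼-^ᴾ n K≼)

module TruncatedWeight (D A L : ℕ) .{{_ : NonZero A}} .{{_ : NonZero L}} where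

  X : ℕ → ℕ
  X e = A ^ e * L ^ ⌊ e /2⌋

  -- W e = W 0 / X e for e ≤ D and 0 beyond; this keeps W integral and, as X is
  -- supermultiplicative, submultiplicative relative to W 0.
  W : ℕ → ℕ
  W e with e ≤? D
  ... | yes _ = A ^ (D ∸ e) * L ^ (⌊ D /2⌋ ∸ ⌊ e /2⌋)
  ... | no _ = 0

  W-≤ : ∀ {e} → e ≤ D → W e ≡ A ^ (D ∸ e) * L ^ (⌊ D /2⌋ ∸ ⌊ e /2⌋)
  W-≤ {e} e≤D with e ≤? D
  ... | yes _ = refl
  ... | no e≰D = contradiction e≤D e≰D

  W-> : ∀ {e} → ¬ e ≤ D → W e ≡ 0
  W-> {e} e≰D with e ≤? D
  ... | yes e≤D = contradiction e≤D e≰D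
  ... | no _ = refl

  W-nonZero : ∀ {e} → e ≤ D → NonZero (W e)
  W-nonZero {e} e≤D = subst NonZero (sym (W-≤ e≤D))
    (m*n≢0 (A ^ (D ∸ e)) (L ^ (⌊ D /2⌋ ∸ ⌊ e /2⌋)) {{m^n≢0 A (D ∸ e)}} {{m^n≢0 L (⌊ D /2⌋ ∸ ⌊ e /2⌋)}})

  instance
    W0-nonZero : NonZero (W 0)
    W0-nonZero = W-nonZero z≤n

  W*X≡W0 : ∀ {e} → e ≤ D → W e * X e ≡ W 0
  W*X≡W0 {e} e≤D = begin
    W e * X e
      ≡⟨ cong (_* X e) (W-≤ e≤D) ⟩
    A ^ (D ∸ e) * L ^ (⌊ D /2⌋ ∸ ⌊ e /2⌋) * (A ^ e * L ^ ⌊ e /2⌋)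
      ≡⟨ [m*n]*[o*p]≡[m*o]*[n*p] (A ^ (D ∸ e)) _ _ _ ⟩
    A ^ (D ∸ e) * A ^ e * (L ^ (⌊ D /2⌋ ∸ ⌊ e /2⌋) * L ^ ⌊ e /2⌋)
      ≡⟨ cong₂ _*_ (^-distribˡ-+-* A (D ∸ e) e) (^-distribˡ-+-* L (⌊ D /2⌋ ∸ ⌊ e /2⌋) ⌊ e /2⌋) ⟨
    A ^ (D ∸ e + e) * L ^ (⌊ D /2⌋ ∸ ⌊ e /2⌋ + ⌊ e /2⌋)
      ≡⟨ cong₂ (λ i j → A ^ i * L ^ j) (m∸n+n≡m e≤D) (m∸n+n≡m (⌊n/2⌋-mono e≤D)) ⟩
    A ^ D * L ^ ⌊ D /2⌋
      ∎
    where open ≡-Reasoning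

  X-nonZero : ∀ e → NonZero (X e)
  X-nonZero e = m*n≢0 (A ^ e) (L ^ ⌊ e /2⌋) {{m^n≢0 A e}} {{m^n≢0 L ⌊ e /2⌋}}

  X-supermult : ∀ a b → X a * X b ≤ X (a + b)
  X-supermult a b = begin
    A ^ a * L ^ ⌊ a /2⌋ * (A ^ b * L ^ ⌊ b /2⌋)
      ≡⟨ [m*n]*[o*p]≡[m*o]*[n*p] (A ^ a) _ _ _ ⟩
    A ^ a * A ^ b * (L ^ ⌊ a /2⌋ * L ^ ⌊ b /2⌋)
      ≡⟨ cong₂ _*_ (^-distribˡ-+-* A a b) (^-distribˡ-+-* L ⌊ a /2⌋ ⌊ b /2⌋) ⟨
    A ^ (a + b) * L ^ (⌊ a /2⌋ + ⌊ b /2⌋)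
      ≤⟨ *-monoʳ-≤ (A ^ (a + b)) (^-monoʳ-≤ L (⌊m/2⌋+⌊n/2⌋≤⌊m+n/2⌋ a b)) ⟩
    A ^ (a + b) * L ^ ⌊ a + b /2⌋
      ∎
    where open ≤-Reasoning

  W-submult : ∀ a b → W (a + b) * W 0 ≤ W a * W b
  W-submult a b = by-cases (a + b ≤? D)
    where

    by-cases : Dec (a + b ≤ D) → W (a + b) * W 0 ≤ W a * W b
    by-cases (no a+b≰D) = ≤-trans (≤-reflexive (cong (_* W 0) (W-> a+b≰D))) z≤n
    by-cases (yes a+b≤D) = *-cancelʳ-≤ _ _ (X a * X b) {{m*n≢0 _ _ {{X-nonZero a}} {{X-nonZero b}}}} (begin
      W (a + b) * W 0 * (X a * X b)     ≤⟨ *-monoʳ-≤ (W (a + b) * W 0) (X-supermult a b) ⟩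
      W (a + b) * W 0 * X (a + b)       ≡⟨ xy∙z≈xz∙y (W (a + b)) (W 0) (X (a + b)) ⟩
      W (a + b) * X (a + b) * W 0       ≡⟨ cong (_* W 0) (W*X≡W0 a+b≤D) ⟩
      W 0 * W 0                         ≡⟨ cong₂ _*_ (W*X≡W0 (m+n≤o⇒m≤o a a+b≤D)) (W*X≡W0 (m+n≤o⇒n≤o a a+b≤D)) ⟨
      W a * X a * (W b * X b)           ≡⟨ [m*n]*[o*p]≡[m*o]*[n*p] (W a) (X a) (W b) (X b) ⟩
      W a * W b * (X a * X b)           ∎)
      where open ≤-Reasoning

  open WeightedSum W W-submult public

  coeff-≤ : ∀ {K c j} → K ≼ c / 1 → j ≤ D → coeff j K ≤ c * X j
  coeff-≤ {K} {c} {j} (weighted≤ K≼) j≤D = *-cancelʳ-≤ _ _ (W j) {{W-nonZero j≤D}} (begin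
    coeff j K * W j    ≤⟨ coeff*W≤Φ j K ⟩
    Φ K                ≡⟨ *-identityʳ (Φ K) ⟨
    Φ K * 1            ≤⟨ K≼ ⟩
    c * W 0            ≡⟨ cong (c *_) (W*X≡W0 j≤D) ⟨
    c * (W j * X j)    ≡⟨ x∙yz≈xz∙y c (W j) (X j) ⟩
    c * X j * W j      ∎)
    where open ≤-Reasoning

-- Coefficients of the reciprocal of I(TG)

module RecipTGEstimates (m t : ℕ) (1≤m : 1 ≤ m) where

  L : ℕ
  L = 2 ^ t

  A : ℕ
  A = 6 * L

  instance
    L-nonZero : NonZero L
    L-nonZero = m^n≢0 2 t
    A-nonZero : NonZero A
    A-nonZero = m*n≢0 6 L

  open TruncatedWeight (2 * m) A L {{A-nonZero}} {{L-nonZero}}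

  private instance
    A^t-nonZero : NonZero (A ^ t)
    A^t-nonZero = m^n≢0 A t
    A*A^t-nonZero : NonZero (A * A ^ t)
    A*A^t-nonZero = m*n≢0 A (A ^ t)
    X2*A^3t-nonZero : NonZero (X 2 * (A ^ t) ^ 3)
    X2*A^3t-nonZero = m*n≢0 (X 2) ((A ^ t) ^ 3) {{X-nonZero 2}} {{m^n≢0 (A ^ t) 3}}

  private
    1≤2m : 1 ≤ 2 * m
    1≤2m = ≤-trans 1≤m (m≤m+n m (m + 0))

    2≤2m : 2 ≤ 2 * m
    2≤2m = *-monoʳ-≤ 2 1≤m

    W1*A≡W0 : W 1 * A ≡ W 0
    W1*A≡W0 = trans (cong (W 1 *_) (sym (trans (*-identityʳ (A * 1)) (*-identityʳ A)))) (W*X≡W0 1≤2m)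

    2t≤A : 2 * t ≤ A
    2t≤A = ≤-trans (*-monoʳ-≤ 2 (<⇒≤ (n<2^n t))) (*-monoˡ-≤ L {2} {6} (s≤s (s≤s z≤n)))

    [1+A]^t≤2A^t : suc A ^ t ≤ 2 * A ^ t
    [1+A]^t≤2A^t = [1+a]^n≤2*a^n t 2t≤A

    [2A+1]^t≤L*2A^t : (A + suc A) ^ t ≤ L * (2 * A ^ t)
    [2A+1]^t≤L*2A^t = begin
      (A + suc A) ^ t      ≤⟨ ^-monoˡ-≤ t (+-mono-≤ (n≤1+n A) (m≤m+n (suc A) 0)) ⟩
      (2 * suc A) ^ t      ≡⟨ ^-distribʳ-* 2 (suc A) t ⟩
      L * suc A ^ t        ≤⟨ *-monoʳ-≤ L [1+A]^t≤2A^t ⟩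
      L * (2 * A ^ t)      ∎
      where open ≤-Reasoning

    [2A+1]^t≤A^[1+t] : (A + suc A) ^ t ≤ 1 * (A * A ^ t)
    [2A+1]^t≤A^[1+t] = begin
      (A + suc A) ^ t      ≤⟨ [2A+1]^t≤L*2A^t ⟩
      L * (2 * A ^ t)      ≡⟨ x∙yz≈y∙xz L 2 (A ^ t) ⟩
      2 * (L * A ^ t)      ≡⟨ *-assoc 2 L (A ^ t) ⟨
      2 * L * A ^ t        ≤⟨ *-monoˡ-≤ (A ^ t) (*-monoˡ-≤ L {2} {6} (s≤s (s≤s z≤n))) ⟩
      A * A ^ t            ≡⟨ *-identityˡ (A * A ^ t) ⟨
      1 * (A * A ^ t)      ∎
      where open ≤-Reasoning

    [2A+1]^3t≤X2*A^3t : ((A + suc A) ^ t) ^ 3 ≤ 1 * (X 2 * (A ^ t) ^ 3)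
    [2A+1]^3t≤X2*A^3t = begin
      ((A + suc A) ^ t) ^ 3         ≤⟨ ^-monoˡ-≤ 3 [2A+1]^t≤L*2A^t ⟩
      (L * (2 * A ^ t)) ^ 3         ≡⟨ cube L (A ^ t) ⟩
      8 * (L ^ 3 * (A ^ t) ^ 3)     ≤⟨ *-monoˡ-≤ (L ^ 3 * (A ^ t) ^ 3) {8} {36} (+-monoʳ-≤ 8 z≤n) ⟩
      36 * (L ^ 3 * (A ^ t) ^ 3)    ≡⟨ X2 L (A ^ t) ⟨
      X 2 * (A ^ t) ^ 3             ≡⟨ *-identityˡ _ ⟨
      1 * (X 2 * (A ^ t) ^ 3)       ∎
      where
      open ≤-Reasoning
      -- The powers are written out because solve-∀ does not accept _^_ here.
      cube : ∀ l a → (l * (2 * a)) * ((l * (2 * a)) * ((l * (2 * a)) * 1)) ≡ 8 * ((l * (l * (l * 1))) * (a * (a * (a * 1))))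
      cube = solve-∀
      X2 : ∀ l a → (6 * l) * ((6 * l) * 1) * (l * 1) * (a * (a * (a * 1))) ≡ 36 * ((l * (l * (l * 1))) * (a * (a * (a * 1))))
      X2 = solve-∀

  1≼A/A : 0 ∷ [] ≼ A / A
  1≼A/A = ≼-weaken ≼-one (≤-reflexive (*-comm 1 A))

  1+x≼ : 0 ∷ 1 ∷ [] ≼ suc A / A
  1+x≼ = subst (0 ∷ 1 ∷ [] ≼_/ A) (+-comm A 1) (≼-++ 1≼A/A (≼-monomial W1*A≡W0))

  2+x≼ : 0 ∷ 0 ∷ 1 ∷ [] ≼ A + suc A / A
  2+x≼ = ≼-++ 1≼A/A 1+x≼

  recipS₂≼ : recipS₂ t ≼ 3 / 1
  recipS₂≼ = ≼-++ {c = 2} {c′ = 1}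
    (≼-integral (≼-^ᴾ t 1+x≼) [1+A]^t≤2A^t)
    (≼-integral (≼-shift 1 A W1*A≡W0 (≼-^ᴾ t 2+x≼)) [2A+1]^t≤A^[1+t])

  recipT≼ : recipT t ≼ 28 / 1
  recipT≼ = ≼-++ {c = 1} {c′ = 27}
    (≼-integral (≼-shift 2 (X 2) (W*X≡W0 2≤2m) (≼-^ᴾ 3 (≼-^ᴾ t 2+x≼))) [2A+1]^3t≤X2*A^3t)
    (≼-^ᴾ 3 recipS₂≼)

  recipTG≼ : recipTG m t ≼ 3 * 28 ^ m / 1
  recipTG≼ = ≼-integral
    (≼-++ (≼-^ᴾ-integral m (≼-^ᴾ 3 recipS₂≼))
          (≼-⊗ (≼-integral {c′ = 2} 1+x≼ 1+A≤2A) (≼-^ᴾ-integral m recipT≼)))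
    (≤-trans (+-monoˡ-≤ (2 * 28 ^ m) (^-monoˡ-≤ m (n≤1+n 27))) (≤-reflexive (sym (*-identityʳ (3 * 28 ^ m)))))
    where
    1+A≤2A : suc A ≤ 2 * A
    1+A≤2A = +-mono-≤ (>-nonZero⁻¹ A) (m≤m+n A 0)

  recipTG-upper : ∀ {j} → j ≤ 2 * m → coeff j (recipTG m t) ≤ 3 * 28 ^ m * X j
  recipTG-upper = coeff-≤ recipTG≼

  recipTG-lower : ∀ {i} → i ≤ m → (L ^ 3) ^ i ≤ coeff (i * 2) (recipTG m t)
  recipTG-lower {i} i≤m = begin
    (L ^ 3) ^ i                                        ≤⟨ coeff-^ᴾ coeff₀-recipT coeff₂-recipT m i≤m ⟩
    coeff (i * 2) (recipT t ^ᴾ m)                      ≡⟨ +-identityʳ _ ⟨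
    1 * coeff (i * 2) (recipT t ^ᴾ m)                  ≤⟨ coeff-⊗ 0 (i * 2) (0 ∷ 1 ∷ []) (recipT t ^ᴾ m) ⟩
    coeff (i * 2) ((0 ∷ 1 ∷ []) ⊗ recipT t ^ᴾ m)       ≤⟨ coeff-++ʳ (i * 2) (recipS₂ t ^ᴾ 3 ^ᴾ m) _ ⟩
    coeff (i * 2) (recipTG m t)                        ∎
    where
    open ≤-Reasoning
    Y = (0 ∷ 0 ∷ 1 ∷ []) ^ᴾ t

    coeff₀-recipS₂ : 1 ≤ coeff 0 (recipS₂ t)
    coeff₀-recipS₂ = ≤-trans (≤-reflexive (sym (^-zeroˡ t)))
      (≤-trans (coeff-0-^ᴾ (0 ∷ 1 ∷ []) t) (coeff-++ˡ 0 ((0 ∷ 1 ∷ []) ^ᴾ t) (shift 1 Y)))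

    coeff₀-recipT : 1 ≤ coeff 0 (recipT t)
    coeff₀-recipT = ≤-trans (^-monoˡ-≤ 3 coeff₀-recipS₂)
      (≤-trans (coeff-0-^ᴾ (recipS₂ t) 3) (coeff-++ʳ 0 (shift 2 (Y ^ᴾ 3)) (recipS₂ t ^ᴾ 3)))

    coeff₂-recipT : L ^ 3 ≤ coeff 2 (recipT t)
    coeff₂-recipT = begin
      L ^ 3                          ≤⟨ ^-monoˡ-≤ 3 (coeff-0-^ᴾ (0 ∷ 0 ∷ 1 ∷ []) t) ⟩
      coeff 0 Y ^ 3                  ≤⟨ coeff-0-^ᴾ Y 3 ⟩
      coeff 0 (Y ^ᴾ 3)               ≡⟨ coeff-shift 2 0 (Y ^ᴾ 3) ⟨
      coeff 2 (shift 2 (Y ^ᴾ 3))     ≤⟨ coeff-++ˡ 2 (shift 2 (Y ^ᴾ 3)) (recipS₂ t ^ᴾ 3) ⟩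
      coeff 2 (recipT t)             ∎

  recipTG-breaks : (3 * 28 ^ m * 6 ^ (2 * m)) * (3 * 28 ^ m * 6 ^ (2 * m)) < L → ∀ {a} → a < m →
    coeff (suc (a * 2)) (recipTG m t) * coeff (suc (a * 2)) (recipTG m t)
    < coeff (suc a * 2) (recipTG m t) * coeff (a * 2) (recipTG m t)
  recipTG-breaks C²<L {a} a<m = begin-strict
    r j * r j                               ≤⟨ *-mono-≤ (recipTG-upper j≤2m) (recipTG-upper j≤2m) ⟩
    (κ * X j) * (κ * X j)                   ≡⟨ cong₂ _*_ κXj≡ κXj≡ ⟩
    (κ * 6 ^ j * P) * (κ * 6 ^ j * P)       ≡⟨ [m*n]*[o*p]≡[m*o]*[n*p] (κ * 6 ^ j) P (κ * 6 ^ j) P ⟩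
    (κ * 6 ^ j) * (κ * 6 ^ j) * (P * P)     <⟨ *-monoˡ-< (P * P) {{m*n≢0 P P {{P-nonZero}} {{P-nonZero}}}} κ6ʲ²<L ⟩
    L * (P * P)                             ≡⟨ L*P*P≡ ⟩
    (L ^ 3) ^ suc a * (L ^ 3) ^ a           ≤⟨ *-mono-≤ (recipTG-lower a<m) (recipTG-lower (<⇒≤ a<m)) ⟩
    r (suc a * 2) * r (a * 2)               ∎
    where
    open ≤-Reasoning
    r : ℕ → ℕ
    r k = coeff k (recipTG m t)
    κ = 3 * 28 ^ m
    j = suc (a * 2)
    P = L ^ (j + a)

    P-nonZero : NonZero P
    P-nonZero = m^n≢0 L (j + a)

    j≤2m : j ≤ 2 * m
    j≤2m = ≤-trans (n≤1+n j) (≤-trans (*-monoˡ-≤ 2 a<m) (≤-reflexive (*-comm m 2)))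

    κXj≡ : κ * X j ≡ κ * 6 ^ j * P
    κXj≡ = begin-equality
      κ * (A ^ j * L ^ ⌊ j /2⌋)       ≡⟨ cong₂ (λ u v → κ * (u * L ^ v)) (^-distribʳ-* 6 L j) (⌊1+n*2/2⌋≡n a) ⟩
      κ * (6 ^ j * L ^ j * L ^ a)     ≡⟨ cong (κ *_) (*-assoc (6 ^ j) (L ^ j) (L ^ a)) ⟩
      κ * (6 ^ j * (L ^ j * L ^ a))   ≡⟨ cong (λ u → κ * (6 ^ j * u)) (^-distribˡ-+-* L j a) ⟨
      κ * (6 ^ j * P)                 ≡⟨ *-assoc κ (6 ^ j) P ⟨
      κ * 6 ^ j * P                   ∎

    κ6ʲ²<L : (κ * 6 ^ j) * (κ * 6 ^ j) < L
    κ6ʲ²<L = ≤-<-trans (*-mono-≤ κ6ʲ≤ κ6ʲ≤) C²<L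
      where
      κ6ʲ≤ : κ * 6 ^ j ≤ κ * 6 ^ (2 * m)
      κ6ʲ≤ = *-monoʳ-≤ κ (^-monoʳ-≤ 6 j≤2m)

    L*P*P≡ : L * (P * P) ≡ (L ^ 3) ^ suc a * (L ^ 3) ^ a
    L*P*P≡ = begin-equality
      L * (P * P)                     ≡⟨ cong (L *_) (^-distribˡ-+-* L (j + a) (j + a)) ⟨
      L ^ (1 + ((j + a) + (j + a)))   ≡⟨ cong (L ^_) (exponents a) ⟩
      L ^ (3 * suc a + 3 * a)         ≡⟨ ^-distribˡ-+-* L (3 * suc a) (3 * a) ⟩
      L ^ (3 * suc a) * L ^ (3 * a)   ≡⟨ cong₂ _*_ (^-*-assoc L 3 (suc a)) (^-*-assoc L 3 a) ⟨
      (L ^ 3) ^ suc a * (L ^ 3) ^ a   ∎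
      where
      exponents : ∀ a → 1 + ((suc (a * 2) + a) + (suc (a * 2) + a)) ≡ 3 * suc a + 3 * a
      exponents = solve-∀

BreaksLCAt-reverse : ∀ (s r : ℕ → ℕ) {N} j → 2 + j ≤ N → (∀ i → i ≤ N → s (N ∸ i) ≡ r i) →
  r (1 + j) * r (1 + j) < r (2 + j) * r j → BreaksLCAt s (N ∸ (1 + j))
BreaksLCAt-reverse s r {N} j 2+j≤N s∘[N∸]≡r breaks = m<n⇒0<n∸m 2+j≤N , (begin-strict
  s k * s k                 ≡⟨ cong₂ _*_ sk≡ sk≡ ⟩
  r (1 + j) * r (1 + j)     <⟨ breaks ⟩
  r (2 + j) * r j           ≡⟨ cong₂ _*_ sk-1≡ sk+1≡ ⟨
  s (k ∸ 1) * s (suc k)     ∎)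
  where
  open ≤-Reasoning
  k = N ∸ (1 + j)
  sk≡ : s k ≡ r (1 + j)
  sk≡ = s∘[N∸]≡r (1 + j) (<⇒≤ 2+j≤N)
  sk-1≡ : s (k ∸ 1) ≡ r (2 + j)
  sk-1≡ = trans (cong s (trans (∸-+-assoc N (1 + j) 1) (cong (N ∸_) (+-comm (1 + j) 1)))) (s∘[N∸]≡r (2 + j) 2+j≤N)
  sk+1≡ : s (suc k) ≡ r j
  sk+1≡ = trans (cong s (sym (+-∸-assoc 1 (<⇒≤ 2+j≤N))))
                (s∘[N∸]≡r j (≤-trans (≤-trans (n≤1+n j) (n≤1+n (1 + j))) 2+j≤N))

theorem2p9 : (m : ℕ) → 1 ≤ m →
    Σ ℕ (λ t₀ → (t : ℕ) → t₀ ≤ t →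
      Σ (Fin m → ℕ) (λ ks → Injective _≡_ _≡_ ks ×
        ((i : Fin m) → BreaksLCAt (indepCoeff (toGraph (TG m t))) (ks i))))
theorem2p9 m 1≤m = C * C , λ t C²≤t →
    index t , index-injective t , λ i →
      BreaksLCAt-reverse (indepCoeff (toGraph (TG m t))) (λ k → coeff k (recipTG m t))
        (toℕ i * 2) (index-bound t (toℕ<n i)) (indepCoeff-TG m t)
        (RecipTGEstimates.recipTG-breaks m t 1≤m (≤-<-trans C²≤t (n<2^n t)) (toℕ<n i))
  where
  C = 3 * 28 ^ m * 6 ^ (2 * m)

  index : ℕ → Fin m → ℕ
  index t i = degTG m t ∸ (1 + toℕ i * 2)

  index-bound : ∀ t {a} → a < m → 2 + a * 2 ≤ degTG m t
  index-bound t a<m = ≤-trans (*-monoˡ-≤ 2 a<m)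
    (≤-trans (*-monoʳ-≤ m (+-mono-≤ {1} {suc t} (s≤s z≤n) (s≤s z≤n))) (n≤1+n _))

  index-injective : ∀ t → Injective _≡_ _≡_ (index t)
  index-injective t {i} {i′} eq = toℕ-injective (*-cancelʳ-≡ (toℕ i) (toℕ i′) 2
    (suc-injective (∸-cancelˡ-≡ (1+i*2≤deg i) (1+i*2≤deg i′) eq)))
    where
    1+i*2≤deg : ∀ i → 1 + toℕ i * 2 ≤ degTG m t
    1+i*2≤deg i = <⇒≤ (index-bound t (toℕ<n i))
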